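{- Over a field $\mathbb K$ of positive characteristic $p$, the subgroup $1+\mathfrak m$ of the shuffle-group of $\mathbb K\langle\!\langle X_1,\dots,X_k\rangle\!\rangle$ is an infinite-dimensional $\mathbb F_p$-vector space.
   Context: $\mathbb K\langle\!\langle X_1,\dots,X_k\rangle\!\rangle$ denotes formal power series in the non-commuting variables $X_1,\dots,X_k$, and $\mathfrak m$ is the ideal of series without constant term. The shuffle product $\mathbf X\sqcup\!\sqcup\mathbf X'$ of two monomials is defined recursively by $\mathbf X\sqcup\!\sqcup1=1\sqcup\!\sqcup\mathbf X=\mathbf X$ and $(\mathbf XX_s)\sqcup\!\sqcup(\mathbf X'X_t)=(\mathbf X\sqcup\!\sqcup(\mathbf X'X_t))X_s+((\mathbf XX_s)\sqcup\!\sqcup\mathbf X')X_t$ (sum over all ways of interleaving the letters), extended bilinearly to power series; it is associative and commutative. The shuffle-group is the set $\mathbb K^*+\mathfrak m$ of shuffle-invertible series, and $1+\mathfrak m$ (series with constant term $1$) is a subgroup under $\sqcup\!\sqcup$. -}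

module Defs where

open import Level using (Level; _⊔_)
open import Algebra.Bundles using (CommutativeRing)
open import Data.Nat using (ℕ; zero; suc; _<_)
open import Data.Fin using (Fin)
open import Data.List using (List; []; _∷_)
open import Data.Product using (∃)
open import Relation.Nullary using (¬_)

module _ {c ℓ} (R : CommutativeRing c ℓ) where
  open CommutativeRing R

  IsField : Set (c ⊔ ℓ)
  IsField = (¬ (1# ≈ 0#)) × (∀ x → ¬ (x ≈ 0#) → ∃ λ y → x * y ≈ 1#)
    where open import Data.Product using (_×_)

  natOne : ℕ → Carrier
  natOne zero    = 0#
  natOne (suc n) = 1# + natOne n

  HasCharacteristic : ℕ → Set ℓ
  HasCharacteristic p =
    (0 < p) × (natOne p ≈ 0#) × (∀ m → 0 < m → m < p → ¬ (natOne m ≈ 0#))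
    where open import Data.Product using (_×_)

  -- Words in the letters X_1..X_k, i.e. Fin k.
  -- CONVENTION: a word is stored reversed: the head of the list is the LAST letter,
  -- so  x ∷ w  represents the monomial  w X_x.
  Word : ℕ → Set
  Word k = List (Fin k)

  Series : ℕ → Set c
  Series k = Word k → Carrier

  _≋_ : ∀ {k} → Series k → Series k → Set ℓ
  f ≋ g = ∀ w → f w ≈ g w

  one : ∀ {k} → Series k
  one []      = 1#
  one (_ ∷ _) = 0#

  -- right quotient by a letter: (∂ x f)(w) = coefficient of w X_x in f
  ∂ : ∀ {k} → Fin k → Series k → Series k
  ∂ x f w = f (x ∷ w)

  -- This is the coefficientwise form of the recursive definition
  --   (u X_s) ⧢ (v X_t) = (u ⧢ v X_t) X_s + (u X_s ⧢ v) X_t ,  u ⧢ 1 = 1 ⧢ u = u,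
  -- extended bilinearly: coeff(w X_x, f ⧢ g) = coeff(w, ∂x f ⧢ g) + coeff(w, f ⧢ ∂x g).
  shuffleCoeff : ∀ {k} → Word k → Series k → Series k → Carrier
  shuffleCoeff []      f g = f [] * g []
  shuffleCoeff (x ∷ w) f g = shuffleCoeff w (∂ x f) g + shuffleCoeff w f (∂ x g)

  _⧢_ : ∀ {k} → Series k → Series k → Series k
  (f ⧢ g) w = shuffleCoeff w f g

  _^⧢_ : ∀ {k} → Series k → ℕ → Series k
  f ^⧢ zero  = one
  f ^⧢ suc n = f ⧢ (f ^⧢ n)

  ∏⧢ : ∀ {k n} → (Fin n → Series k) → Series k
  ∏⧢ {n = zero}  F = one
  ∏⧢ {n = suc n} F = F Fin.zero ⧢ ∏⧢ (λ i → F (Fin.suc i))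
    where import Data.Fin as Fin

  InOnePlusM : ∀ {k} → Series k → Set ℓ
  InOnePlusM f = f [] ≈ 1#

  -- (1+𝔪, ⧢) viewed as an F_p-vector space (scalar c ∈ {0,…,p-1} acts by f ↦ f^⧢c):
  -- every element is killed by p
  ExponentDivides : ℕ → ℕ → Set (c ⊔ ℓ)
  ExponentDivides p k = ∀ (f : Series k) → InOnePlusM f → (f ^⧢ p) ≋ one

  FpIndependent : ∀ {k n} → ℕ → (Fin n → Series k) → Set ℓ
  FpIndependent {n = n} p F =
    ∀ (cs : Fin n → ℕ) → (∀ i → cs i < p) →
      ∏⧢ (λ i → F i ^⧢ cs i) ≋ one → ∀ i → cs i ≡ 0
    where open import Relation.Binary.PropositionalEquality using (_≡_)

  InfiniteDimensional : ℕ → ℕ → Set (c ⊔ ℓ)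
  InfiniteDimensional p k =
    ∀ (n : ℕ) → ∃ λ (F : Fin n → Series k) → (∀ i → InOnePlusM (F i)) × FpIndependent p F
    where open import Data.Product using (_×_)

module Submission where

open import Defs
open import Level using (Level)
open import Algebra.Bundles using (CommutativeRing)
open import Data.Nat using (ℕ; _≤_)
open import Data.Product using (_×_)

open import Data.Nat using (zero; suc; pred; _<_; z<s; s≤s)
import Data.Nat as ℕ
import Data.Nat.Properties as ℕₚ
open import Data.Fin using (Fin; toℕ; punchIn)
import Data.Fin as Fin
open import Data.Fin.Properties using (toℕ-injective; toℕ<n; punchInᵢ≢i)
open import Data.List using ([]; _∷_; length; replicate)
open import Data.List.Properties using (length-replicate)
open import Data.Product using (_,_)
open import Relation.Nullary using (yes; no; contradiction)
open import Relation.Binary.PropositionalEquality as ≡ using (_≡_; _≢_)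

-- (1) Exponent p.  The letter derivations ∂ₓ are derivations of ⧢, hence
--     ∂ₓ (f^(n+1)) = (n+1) · (∂ₓ f ⧢ f^n).  If p · 1 = 0 then every
--     non-constant coefficient of f^p vanishes, so f^p = 1 for f ∈ 1 + 𝔪.
--
-- (2) Independence.  Call u of order m if it vanishes on words shorter than m.
--     For u, v of order m, (1 + u) ⧢ (1 + v) ≡ 1 + u + v on words shorter than
--     2m, since u ⧢ v has order 2m.  With λ_d the sum of all words of length d,
--     the elements E_i = 1 + λ_{n+i} (i < n) thus satisfy
--     ∏ E_i^(c_i) ≡ 1 + Σ c_i λ_{n+i} below length 2n.  If the product is 1,
--     evaluating at a word of length n + j gives c_j · 1 = 0, so c_j = 0
--     when c_j < p and p is the characteristic.

module ShuffleAlgebra {c ℓ} (K : CommutativeRing c ℓ) {k : ℕ} where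
  open CommutativeRing K hiding (zero)
  open import Relation.Binary.Reasoning.Setoid setoid
  open import Algebra.Properties.CommutativeSemigroup +-commutativeSemigroup using (interchange)
  open import Algebra.Properties.CommutativeSemigroup *-commutativeSemigroup using (x∙yz≈y∙xz)
  open import Algebra.Properties.Group +-group using (identityʳ-unique)
  open import Algebra.Properties.CommutativeMonoid.Sum +-commutativeMonoid
    using (sum; sum-remove; sum-cong-≋; sum-replicate-zero)

  𝕊 : Set c
  𝕊 = Series K k

  infixl 7 _⧢ᴷ_ _·_
  infixl 6 _⊕_
  infix  4 _≋ᴷ_

  _⧢ᴷ_ : 𝕊 → 𝕊 → 𝕊
  _⧢ᴷ_ = _⧢_ K

  _^ᴷ_ : 𝕊 → ℕ → 𝕊
  _^ᴷ_ = _^⧢_ K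

  _≋ᴷ_ : 𝕊 → 𝕊 → Set ℓ
  _≋ᴷ_ = _≋_ K

  1ᴷ 0ᴷ : 𝕊
  1ᴷ = one K
  0ᴷ _ = 0#

  _⊕_ : 𝕊 → 𝕊 → 𝕊
  (f ⊕ g) w = f w + g w

  _·_ : Carrier → 𝕊 → 𝕊
  (a · f) w = a * f w

  Agree : ℕ → 𝕊 → 𝕊 → Set ℓ
  Agree N f g = ∀ w → length w < N → f w ≈ g w

  ∂-agree : ∀ {N f g} x → Agree N f g → Agree (pred N) (∂ K x f) (∂ K x g)
  ∂-agree {suc N} x f≈g w lt = f≈g (x ∷ w) (s≤s lt)

  agree-pred : ∀ {N f g} → Agree N f g → Agree (pred N) f g
  agree-pred {suc N} f≈g w lt = f≈g w (ℕₚ.m<n⇒m<1+n lt)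

  ⧢-local : ∀ {N f f′ g g′} → Agree N f f′ → Agree N g g′ → Agree N (f ⧢ᴷ g) (f′ ⧢ᴷ g′)
  ⧢-local f≈ g≈ []      lt = *-cong (f≈ [] lt) (g≈ [] lt)
  ⧢-local f≈ g≈ (x ∷ w) lt =
    +-cong (⧢-local (∂-agree x f≈) (agree-pred g≈) w (ℕₚ.suc[m]≤n⇒m≤pred[n] lt))
           (⧢-local (agree-pred f≈) (∂-agree x g≈) w (ℕₚ.suc[m]≤n⇒m≤pred[n] lt))

  ⧢-cong : ∀ {f f′ g g′} → f ≋ᴷ f′ → g ≋ᴷ g′ → f ⧢ᴷ g ≋ᴷ f′ ⧢ᴷ g′
  ⧢-cong f≈ g≈ w = ⧢-local {N = suc (length w)} (λ v _ → f≈ v) (λ v _ → g≈ v) w ℕₚ.≤-refl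

  -- The algebra laws of ⧢.  Each is proved by induction on the word, since the
  -- defining recursion is the Leibniz rule  ∂ₓ (f ⧢ g) = ∂ₓ f ⧢ g + f ⧢ ∂ₓ g.
  ⧢-comm : ∀ f g → f ⧢ᴷ g ≋ᴷ g ⧢ᴷ f
  ⧢-comm f g []      = *-comm _ _
  ⧢-comm f g (x ∷ w) = trans (+-cong (⧢-comm _ _ w) (⧢-comm _ _ w)) (+-comm _ _)

  ⧢-distribʳ : ∀ f f′ g → (f ⊕ f′) ⧢ᴷ g ≋ᴷ f ⧢ᴷ g ⊕ f′ ⧢ᴷ g
  ⧢-distribʳ f f′ g []      = distribʳ _ _ _
  ⧢-distribʳ f f′ g (x ∷ w) =
    trans (+-cong (⧢-distribʳ _ _ _ w) (⧢-distribʳ _ _ _ w)) (interchange _ _ _ _)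

  ⧢-distribˡ : ∀ f g g′ → f ⧢ᴷ (g ⊕ g′) ≋ᴷ f ⧢ᴷ g ⊕ f ⧢ᴷ g′
  ⧢-distribˡ f g g′ w = begin
    (f ⧢ᴷ (g ⊕ g′)) w           ≈⟨ ⧢-comm f _ w ⟩
    ((g ⊕ g′) ⧢ᴷ f) w           ≈⟨ ⧢-distribʳ g g′ f w ⟩
    (g ⧢ᴷ f) w + (g′ ⧢ᴷ f) w    ≈⟨ +-cong (⧢-comm g f w) (⧢-comm g′ f w) ⟩
    (f ⧢ᴷ g) w + (f ⧢ᴷ g′) w    ∎

  ⧢-scalarʳ : ∀ a f g → f ⧢ᴷ (a · g) ≋ᴷ a · (f ⧢ᴷ g)
  ⧢-scalarʳ a f g []      = x∙yz≈y∙xz _ _ _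
  ⧢-scalarʳ a f g (x ∷ w) =
    trans (+-cong (⧢-scalarʳ a _ _ w) (⧢-scalarʳ a _ _ w)) (sym (distribˡ _ _ _))

  ⧢-zeroʳ : ∀ f → f ⧢ᴷ 0ᴷ ≋ᴷ 0ᴷ
  ⧢-zeroʳ f []      = zeroʳ _
  ⧢-zeroʳ f (x ∷ w) = trans (+-cong (⧢-zeroʳ _ w) (⧢-zeroʳ _ w)) (+-identityʳ 0#)

  -- ∂ₓ 1 = 0 holds definitionally, which is all the unit law needs.
  ⧢-identityʳ : ∀ f → f ⧢ᴷ 1ᴷ ≋ᴷ f
  ⧢-identityʳ f []      = *-identityʳ _
  ⧢-identityʳ f (x ∷ w) = trans (+-cong (⧢-identityʳ _ w) (⧢-zeroʳ f w)) (+-identityʳ _)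

  ⧢-identityˡ : ∀ f → 1ᴷ ⧢ᴷ f ≋ᴷ f
  ⧢-identityˡ f w = trans (⧢-comm 1ᴷ f w) (⧢-identityʳ f w)

  ⧢-assoc : ∀ f g h → (f ⧢ᴷ g) ⧢ᴷ h ≋ᴷ f ⧢ᴷ (g ⧢ᴷ h)
  ⧢-assoc f g h []      = *-assoc _ _ _
  ⧢-assoc f g h (x ∷ w) = begin
    ((∂x f ⧢ᴷ g ⊕ f ⧢ᴷ ∂x g) ⧢ᴷ h) w + ((f ⧢ᴷ g) ⧢ᴷ ∂x h) w
      ≈⟨ +-congʳ (⧢-distribʳ _ _ _ w) ⟩
    (((∂x f ⧢ᴷ g) ⧢ᴷ h) w + ((f ⧢ᴷ ∂x g) ⧢ᴷ h) w) + ((f ⧢ᴷ g) ⧢ᴷ ∂x h) w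
      ≈⟨ +-cong (+-cong (⧢-assoc _ _ _ w) (⧢-assoc _ _ _ w)) (⧢-assoc _ _ _ w) ⟩
    ((∂x f ⧢ᴷ (g ⧢ᴷ h)) w + (f ⧢ᴷ (∂x g ⧢ᴷ h)) w) + (f ⧢ᴷ (g ⧢ᴷ ∂x h)) w
      ≈⟨ +-assoc _ _ _ ⟩
    (∂x f ⧢ᴷ (g ⧢ᴷ h)) w + ((f ⧢ᴷ (∂x g ⧢ᴷ h)) w + (f ⧢ᴷ (g ⧢ᴷ ∂x h)) w)
      ≈⟨ +-congˡ (⧢-distribˡ _ _ _ w) ⟨
    (∂x f ⧢ᴷ (g ⧢ᴷ h)) w + (f ⧢ᴷ (∂x g ⧢ᴷ h ⊕ g ⧢ᴷ ∂x h)) w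
      ∎
    where ∂x = ∂ K x

  ∂-power : ∀ f x n → ∂ K x (f ^ᴷ suc n) ≋ᴷ natOne K (suc n) · (∂ K x f ⧢ᴷ f ^ᴷ n)
  ∂-power f x zero w = begin
    (∂ K x f ⧢ᴷ 1ᴷ) w + (f ⧢ᴷ 0ᴷ) w     ≈⟨ +-congˡ (⧢-zeroʳ f w) ⟩
    (∂ K x f ⧢ᴷ 1ᴷ) w + 0#              ≈⟨ +-identityʳ _ ⟩
    (∂ K x f ⧢ᴷ 1ᴷ) w                   ≈⟨ *-identityˡ _ ⟨
    1# * (∂ K x f ⧢ᴷ 1ᴷ) w              ≈⟨ *-congʳ (+-identityʳ 1#) ⟨
    (1# + 0#) * (∂ K x f ⧢ᴷ 1ᴷ) w       ∎
  ∂-power f x (suc n) w = begin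
    a + (f ⧢ᴷ ∂ K x (f ^ᴷ suc n)) w                  ≈⟨ +-congˡ (⧢-cong (λ _ → refl) (∂-power f x n) w) ⟩
    a + (f ⧢ᴷ (N · (∂ K x f ⧢ᴷ f ^ᴷ n))) w          ≈⟨ +-congˡ (⧢-scalarʳ N f _ w) ⟩
    a + N * (f ⧢ᴷ (∂ K x f ⧢ᴷ f ^ᴷ n)) w            ≈⟨ +-congˡ (*-congˡ (⧢-assoc _ _ _ w)) ⟨
    a + N * ((f ⧢ᴷ ∂ K x f) ⧢ᴷ f ^ᴷ n) w            ≈⟨ +-congˡ (*-congˡ (⧢-cong (⧢-comm f _) (λ _ → refl) w)) ⟩
    a + N * ((∂ K x f ⧢ᴷ f) ⧢ᴷ f ^ᴷ n) w            ≈⟨ +-congˡ (*-congˡ (⧢-assoc _ _ _ w)) ⟩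
    a + N * a                                         ≈⟨ +-congʳ (*-identityˡ a) ⟨
    1# * a + N * a                                    ≈⟨ distribʳ _ _ _ ⟨
    (1# + N) * a                                      ∎
    where
      N = natOne K (suc n)
      a = (∂ K x f ⧢ᴷ f ^ᴷ suc n) w

  power-constant : ∀ f → f [] ≈ 1# → ∀ n → (f ^ᴷ n) [] ≈ 1#
  power-constant f f₀≈1 zero    = refl
  power-constant f f₀≈1 (suc n) = trans (*-cong f₀≈1 (power-constant f f₀≈1 n)) (*-identityˡ 1#)

  exponent-divides : ∀ q → natOne K (suc q) ≈ 0# → ExponentDivides K (suc q) k
  exponent-divides q q·1≈0 f f₀≈1 []      = power-constant f f₀≈1 (suc q)
  exponent-divides q q·1≈0 f f₀≈1 (x ∷ w) =
    trans (∂-power f x q w) (trans (*-congʳ q·1≈0) (zeroˡ _))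

  HasOrder : ℕ → 𝕊 → Set ℓ
  HasOrder m u = Agree m u 0ᴷ

  -- Arithmetic for order-⧢: stripping the last letter of w lowers the bound a + b
  -- to pred a + b (the order of ∂ₓ f plus that of g).
  pred-left : ∀ {n} a b → suc n < a ℕ.+ b → n < pred a ℕ.+ b
  pred-left zero    b lt = ℕₚ.<-trans (ℕₚ.n<1+n _) lt
  pred-left (suc a) b lt = ℕₚ.≤-pred lt

  order-⧢ : ∀ {a b f g} → HasOrder a f → HasOrder b g → HasOrder (a ℕ.+ b) (f ⧢ᴷ g)
  order-⧢ {suc a} f₀ g₀ []      lt = trans (*-congʳ (f₀ [] z<s)) (zeroˡ _)
  order-⧢ {zero}  f₀ g₀ []      lt = trans (*-congˡ (g₀ [] lt)) (zeroʳ _)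
  order-⧢ {a} {b} {f} {g} f₀ g₀ (x ∷ w) lt = begin
    (∂ K x f ⧢ᴷ g) w + (f ⧢ᴷ ∂ K x g) w   ≈⟨ +-congˡ (⧢-comm f _ w) ⟩
    (∂ K x f ⧢ᴷ g) w + (∂ K x g ⧢ᴷ f) w   ≈⟨ +-cong left right ⟩
    0# + 0#                               ≈⟨ +-identityʳ 0# ⟩
    0#                                    ∎
    where
      left  : (∂ K x f ⧢ᴷ g) w ≈ 0#
      left  = order-⧢ (∂-agree x f₀) g₀ w (pred-left a b lt)
      right : (∂ K x g ⧢ᴷ f) w ≈ 0#
      right = order-⧢ (∂-agree x g₀) f₀ w (pred-left b a (≡.subst (suc (length w) <_) (ℕₚ.+-comm a b) lt))

  order-· : ∀ {m} a {u} → HasOrder m u → HasOrder m (a · u)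
  order-· a u₀ w lt = trans (*-congˡ (u₀ w lt)) (zeroʳ a)

  one-plus-⧢ : ∀ u v → (1ᴷ ⊕ u) ⧢ᴷ (1ᴷ ⊕ v) ≋ᴷ 1ᴷ ⊕ ((u ⊕ v) ⊕ u ⧢ᴷ v)
  one-plus-⧢ u v w = begin
    ((1ᴷ ⊕ u) ⧢ᴷ (1ᴷ ⊕ v)) w
      ≈⟨ ⧢-distribʳ 1ᴷ u _ w ⟩
    (1ᴷ ⧢ᴷ (1ᴷ ⊕ v)) w + (u ⧢ᴷ (1ᴷ ⊕ v)) w
      ≈⟨ +-cong (⧢-identityˡ _ w) (⧢-distribˡ u 1ᴷ v w) ⟩
    (1ᴷ w + v w) + ((u ⧢ᴷ 1ᴷ) w + (u ⧢ᴷ v) w)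
      ≈⟨ +-congˡ (+-congʳ (⧢-identityʳ u w)) ⟩
    (1ᴷ w + v w) + (u w + (u ⧢ᴷ v) w)
      ≈⟨ +-assoc _ _ _ ⟩
    1ᴷ w + (v w + (u w + (u ⧢ᴷ v) w))
      ≈⟨ +-congˡ (+-assoc _ _ _) ⟨
    1ᴷ w + ((v w + u w) + (u ⧢ᴷ v) w)
      ≈⟨ +-congˡ (+-congʳ (+-comm _ _)) ⟩
    1ᴷ w + ((u w + v w) + (u ⧢ᴷ v) w)
      ∎

  near-one-⧢ : ∀ {m f g u v} → HasOrder m u → HasOrder m v →
    Agree (m ℕ.+ m) f (1ᴷ ⊕ u) → Agree (m ℕ.+ m) g (1ᴷ ⊕ v) → Agree (m ℕ.+ m) (f ⧢ᴷ g) (1ᴷ ⊕ (u ⊕ v))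
  near-one-⧢ {f = f} {g} {u} {v} u₀ v₀ f≈ g≈ w lt = begin
    (f ⧢ᴷ g) w                               ≈⟨ ⧢-local f≈ g≈ w lt ⟩
    ((1ᴷ ⊕ u) ⧢ᴷ (1ᴷ ⊕ v)) w                 ≈⟨ one-plus-⧢ u v w ⟩
    1ᴷ w + ((u w + v w) + (u ⧢ᴷ v) w)        ≈⟨ +-congˡ (+-congˡ (order-⧢ u₀ v₀ w lt)) ⟩
    1ᴷ w + ((u w + v w) + 0#)                ≈⟨ +-congˡ (+-identityʳ _) ⟩
    1ᴷ w + (u w + v w)                       ∎

  near-one-power : ∀ {m f u} → HasOrder m u → Agree (m ℕ.+ m) f (1ᴷ ⊕ u) →
    ∀ c → Agree (m ℕ.+ m) (f ^ᴷ c) (1ᴷ ⊕ natOne K c · u)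
  near-one-power u₀ f≈ zero    w lt = sym (trans (+-congˡ (zeroˡ _)) (+-identityʳ _))
  near-one-power {u = u} u₀ f≈ (suc c) w lt =
    trans (near-one-⧢ u₀ (order-· (natOne K c) u₀) f≈ (near-one-power u₀ f≈ c) w lt)
          (+-congˡ (trans (+-congʳ (sym (*-identityˡ (u w)))) (sym (distribʳ _ _ _))))

  sum-zero : ∀ {n} (t : Fin n → Carrier) → (∀ i → t i ≈ 0#) → sum t ≈ 0#
  sum-zero {n} t t≈0 = trans (sum-cong-≋ t≈0) (sum-replicate-zero n)

  sum-delta : ∀ {n} (t : Fin (suc n) → Carrier) j → (∀ i → i ≢ j → t i ≈ 0#) → sum t ≈ t j
  sum-delta t j off = begin
    sum t                                   ≈⟨ sum-remove {i = j} t ⟩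
    t j + sum (λ i → t (punchIn j i))        ≈⟨ +-congˡ (sum-zero _ (λ i → off _ (punchInᵢ≢i j i))) ⟩
    t j + 0#                                ≈⟨ +-identityʳ _ ⟩
    t j                                     ∎

  near-one-product : ∀ {m n} (G U : Fin n → 𝕊) → (∀ i → HasOrder m (U i)) →
    (∀ i → Agree (m ℕ.+ m) (G i) (1ᴷ ⊕ U i)) →
    Agree (m ℕ.+ m) (∏⧢ K G) (1ᴷ ⊕ (λ w → sum (λ i → U i w)))
  near-one-product {n = zero}  G U U₀ G≈ w lt = sym (+-identityʳ _)
  near-one-product {n = suc n} G U U₀ G≈ =
    near-one-⧢ (U₀ Fin.zero) (λ w lt → sum-zero _ (λ i → U₀ (Fin.suc i) w lt)) (G≈ Fin.zero)
      (near-one-product (λ i → G (Fin.suc i)) (λ i → U (Fin.suc i)) (λ i → U₀ (Fin.suc i)) (λ i → G≈ (Fin.suc i)))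

  layer : ℕ → 𝕊
  layer d w with length w ℕₚ.≟ d
  ... | yes _ = 1#
  ... | no  _ = 0#

  layer-on : ∀ d w → length w ≡ d → layer d w ≈ 1#
  layer-on d w eq with length w ℕₚ.≟ d
  ... | yes _  = refl
  ... | no  ne = contradiction eq ne

  layer-off : ∀ d w → length w ≢ d → layer d w ≈ 0#
  layer-off d w ne with length w ℕₚ.≟ d
  ... | yes eq = contradiction eq ne
  ... | no  _  = refl

  layer-order : ∀ m i → HasOrder m (layer (m ℕ.+ i))
  layer-order m i w lt = layer-off _ w (λ eq → ℕₚ.<⇒≱ lt (≡.subst (m ≤_) (≡.sym eq) (ℕₚ.m≤m+n m i)))

  basis : ∀ n → Fin n → 𝕊
  basis n i = 1ᴷ ⊕ layer (n ℕ.+ toℕ i)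

  basis-unit : ∀ n i → InOnePlusM K (basis n i)
  basis-unit (suc n) i = trans (+-congˡ (layer-off (suc n ℕ.+ toℕ i) [] (λ ()))) (+-identityʳ 1#)

  basis-relation : Fin k → ∀ n (cs : Fin n → ℕ) →
    ∏⧢ K (λ i → basis n i ^ᴷ cs i) ≋ᴷ 1ᴷ → ∀ j → natOne K (cs j) ≈ 0#
  basis-relation a zero     cs prod≈1 ()
  basis-relation a (suc n′) cs prod≈1 j = begin
    natOne K (cs j)                  ≈⟨ *-identityʳ _ ⟨
    natOne K (cs j) * 1#             ≈⟨ *-congˡ (layer-on _ w len-w) ⟨
    U j w                            ≈⟨ sum-delta (λ i → U i w) j off ⟨
    sum (λ i → U i w)                ≈⟨ identityʳ-unique (1ᴷ w) _ (trans (sym (truncated w lt)) (prod≈1 w)) ⟩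
    0#                               ∎
    where
      n = suc n′
      U : Fin n → 𝕊
      U i = natOne K (cs i) · layer (n ℕ.+ toℕ i)
      truncated : Agree (n ℕ.+ n) (∏⧢ K (λ i → basis n i ^ᴷ cs i)) (1ᴷ ⊕ (λ w → sum (λ i → U i w)))
      truncated = near-one-product _ U (λ i → order-· _ (layer-order n (toℕ i)))
        (λ i → near-one-power (layer-order n (toℕ i)) (λ _ _ → refl) (cs i))
      w = replicate (n ℕ.+ toℕ j) a
      len-w : length w ≡ n ℕ.+ toℕ j
      len-w = length-replicate (n ℕ.+ toℕ j)
      lt : length w < n ℕ.+ n
      lt = ≡.subst (_< n ℕ.+ n) (≡.sym len-w) (ℕₚ.+-monoʳ-< n (toℕ<n j))
      off : ∀ i → i ≢ j → U i w ≈ 0#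
      off i i≢j = trans (*-congˡ (layer-off _ w (λ eq →
        i≢j (toℕ-injective (ℕₚ.+-cancelˡ-≡ n _ _ (≡.trans (≡.sym eq) len-w)))))) (zeroʳ _)

  below-characteristic : ∀ {p} → HasCharacteristic K p → ∀ c → c < p → natOne K c ≈ 0# → c ≡ 0
  below-characteristic _                 zero    _   _   = ≡.refl
  below-characteristic (_ , _ , minimal) (suc c) c<p c≈0 = contradiction c≈0 (minimal (suc c) z<s c<p)

  infinite-dimensional : ∀ {p} → HasCharacteristic K p → Fin k → InfiniteDimensional K p k
  infinite-dimensional {p} char a n = basis n , basis-unit n , independent
    where
      independent : FpIndependent K p (basis n)
      independent cs cs<p prod≈1 j =
        below-characteristic char (cs j) (cs<p j) (basis-relation a n cs prod≈1 j)

proposition8p1 : ∀ {c ℓ} (K : CommutativeRing c ℓ) → IsField K →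
    (p : ℕ) → HasCharacteristic K p →
    (k : ℕ) → 1 ≤ k →
    ExponentDivides K p k × InfiniteDimensional K p k
proposition8p1 K _ zero    (() , _) k _
proposition8p1 K _ (suc q) char@(_ , q·1≈0 , _) (suc k) _ =
  ShuffleAlgebra.exponent-divides K q q·1≈0 , ShuffleAlgebra.infinite-dimensional K char Fin.zero
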